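{- Let $S\subseteq\{0,1,\dots,9\}$ and for each prime $p$ let $$\nu_p(S)=\#\Bigl\{n\bmod p^2: p^2\mid n \text{ or } p^2\mid(10n+d)\text{ for some } d\in S\Bigr\}.$$ Then the infinite product $$C(S)=\prod_{p \text{ prime}}\left(1-\frac{\nu_p(S)}{p^2}\right)$$ converges absolutely. Moreover, with $C_z(S)=\prod_{p\le z,\ p\text{ prime}}\left(1-\frac{\nu_p(S)}{p^2}\right)$, there is an absolute constant $K$ such that for every $z\ge 7$, $$|C(S)-C_z(S)|\le \frac{K}{z}.$$ -}

module Defs where

open import Data.Nat using (ℕ; zero; suc; _+_; _*_)
open import Data.Nat.Divisibility using (_∣_; _∣?_)
open import Data.Nat.Primality using (Prime; prime?)
open import Data.Fin using (Fin; toℕ)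
open import Data.Fin.Subset using (Subset; _∈_)
open import Data.Fin.Subset.Properties using (_∈?_)
open import Data.Fin.Properties using (any?)
open import Data.Product using (∃; _×_)
open import Data.Sum using (_⊎_)
open import Data.Sum.Relation.Unary.All using ()
open import Data.List using (List; length; filter; upTo)
open import Data.Integer using (+_)
open import Data.Rational using (ℚ; _-_; _/_; 1ℚ; 0ℚ)
import Data.Rational as Q
open import Relation.Nullary using (Dec; yes; no)
open import Relation.Nullary.Decidable using (_⊎-dec_; _×-dec_)

Digits : Set
Digits = Subset 10

Bad : ℕ → Digits → ℕ → Set
Bad p S n = (p * p ∣ n) ⊎ ∃ λ (d : Fin 10) → (d ∈ S) × (p * p ∣ 10 * n + toℕ d)

bad? : (p : ℕ) (S : Digits) (n : ℕ) → Dec (Bad p S n)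
bad? p S n = (p * p ∣? n) ⊎-dec any? (λ d → (d ∈? S) ×-dec (p * p ∣? 10 * n + toℕ d))

ν : ℕ → Digits → ℕ
ν p S = length (filter (bad? p S) (upTo (p * p)))

-- Local factor 1 - ν_p(S)/p² for a prime p; factor 1 for non-primes.
-- (Indexed by m = suc k so that p² is syntactically nonzero.)
factor : Digits → ℕ → ℚ
factor S zero = 1ℚ
factor S (suc k) with prime? (suc k)
... | yes _ = 1ℚ - ((+ ν (suc k) S) / (suc k * suc k))
... | no  _ = 1ℚ

term : Digits → ℕ → ℚ
term S zero = 0ℚ
term S (suc k) with prime? (suc k)
... | yes _ = (+ ν (suc k) S) / (suc k * suc k)
... | no  _ = 0ℚ

Cz : Digits → ℕ → ℚ
Cz S zero = factor S zero
Cz S (suc z) = Cz S z Q.* factor S (suc z)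

Σterm : Digits → ℕ → ℚ
Σterm S zero = term S zero
Σterm S (suc z) = Σterm S z Q.+ term S (suc z)

-- A bad residue n mod p² is either 0 or, when 10 n + d = q p² with d ∈ S, determined by the
-- pair (d, q), where q < 10 because n < p²; hence ν_p(S) ≤ 1 + 10 · 10 and the p-th term is at
-- most 101/p². Since B/k² ≤ 2B (1/k - 1/(k+1)), a sequence whose k-th increment is at most B/k²
-- moves by at most 2B/(m+1) after index m. This applies to the partial sums of ν_p(S)/p², and to
-- -C_z, whose increment C_{k-1} ν_k/k² is at most ν_k/k² because 0 ≤ C_z ≤ 1 and C_z is
-- nonincreasing. So K = 202 works for every z, not only for z ≥ 7.
module Submission where

open import Defs
open import Data.Nat as ℕ using (ℕ; zero; suc; ≤′-refl; ≤′-step)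
open import Data.Product using (∃; _×_; _,_; proj₁; proj₂)
open import Level using (Level; 0ℓ)
open import Relation.Binary.PropositionalEquality

module BadResidues where

  open import Data.Empty using (⊥-elim)
  open import Data.Fin using (Fin; toℕ; fromℕ<; combine)
  open import Data.Fin.Properties using (injective⇒≤; toℕ<n; combine-injective; suc-injective; fromℕ<-injective)
  open import Data.List using (List; _∷_; length; filter; upTo; lookup)
  open import Data.List.Membership.Propositional using (_∈_)
  open import Data.List.Membership.Propositional.Properties using (∈-lookup; ∈-filter⁻; ∈-upTo⁻)
  open import Data.List.Properties using (length-filter; length-upTo)
  open import Data.List.Relation.Unary.All as All using ()
  open import Data.List.Relation.Unary.AllPairs using (_∷_)
  open import Data.List.Relation.Unary.Unique.Propositional using (Unique)
  open import Data.List.Relation.Unary.Unique.Propositional.Properties using (filter⁺; upTo⁺)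
  open import Data.Nat using (_+_; _*_; _≤_; _<_)
  open import Data.Nat.Divisibility using (_∣_; divides; ∣⇒≤)
  open import Data.Nat.Properties
    using (<⇒≱; *-suc; *-cancelʳ-<; +-monoʳ-<; +-comm; *-monoʳ-≤; *-cancelˡ-≡; +-cancelʳ-≡; ≤-trans; ≤-reflexive;
           module ≤-Reasoning)
  open import Data.Sum using (inj₁; inj₂)
  open import Function.Definitions using (Injective)
  open import Relation.Nullary using (contradiction)
  open import Relation.Unary using (Pred; Decidable)

  private
    variable
      a ℓ : Level
      A : Set a

  Unique⇒lookup-injective : {xs : List A} → Unique xs → Injective _≡_ _≡_ (lookup xs)
  Unique⇒lookup-injective (_ ∷ _) {Fin.zero} {Fin.zero} _ = refl
  Unique⇒lookup-injective (x∉ ∷ _) {Fin.zero} {Fin.suc j} eq = ⊥-elim (All.lookup x∉ (∈-lookup j) eq)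
  Unique⇒lookup-injective (x∉ ∷ _) {Fin.suc i} {Fin.zero} eq = ⊥-elim (All.lookup x∉ (∈-lookup i) (sym eq))
  Unique⇒lookup-injective (_ ∷ u) {Fin.suc i} {Fin.suc j} eq = cong Fin.suc (Unique⇒lookup-injective u eq)

  length-filter≤-encoding : {P : Pred A ℓ} (P? : Decidable P) {xs : List A} {k : ℕ} → Unique xs →
    (code : ∀ {x} → x ∈ xs → P x → Fin k) →
    (∀ {x y x∈ y∈} {px : P x} {py : P y} → code x∈ px ≡ code y∈ py → x ≡ y) →
    length (filter P? xs) ≤ k
  length-filter≤-encoding P? {xs} uniq code code-injective =
    injective⇒≤ {f = encodeFiltered} λ eq → Unique⇒lookup-injective (filter⁺ P? uniq) (code-injective eq)
    where
      encodeFiltered : Fin (length (filter P? xs)) → Fin _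
      encodeFiltered i with x∈ , px ← ∈-filter⁻ P? (∈-lookup i) = code x∈ px

  ∣∧<⇒≡0 : ∀ {m n} → m ∣ n → n < m → n ≡ 0
  ∣∧<⇒≡0 {n = zero} _ _ = refl
  ∣∧<⇒≡0 {n = suc _} m∣n n<m = contradiction (∣⇒≤ m∣n) (<⇒≱ n<m)

  quotient<10 : ∀ {m n q} (d : Fin 10) → n < m → 10 * n + toℕ d ≡ q * m → q < 10
  quotient<10 {m} {n} {q} d n<m eq = *-cancelʳ-< m q 10 (begin-strict
    q * m           ≡⟨ eq ⟨
    10 * n + toℕ d  <⟨ +-monoʳ-< (10 * n) (toℕ<n d) ⟩
    10 * n + 10     ≡⟨ +-comm (10 * n) 10 ⟩
    10 + 10 * n     ≡⟨ *-suc 10 n ⟨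
    10 * suc n      ≤⟨ *-monoʳ-≤ 10 n<m ⟩
    10 * m          ∎)
    where open ≤-Reasoning

  module _ (p : ℕ) (S : Digits) where

    encodeBad : ∀ {n} → n < p * p → Bad p S n → Fin 101
    encodeBad _ (inj₁ _) = Fin.zero
    encodeBad {n} n<p² (inj₂ (d , _ , divides q eq)) =
      Fin.suc (combine d (fromℕ< (quotient<10 {p * p} {n} {q} d n<p² eq)))

    encodeBad-injective : ∀ {n m} {n<p² : n < p * p} {m<p² : m < p * p} {bn : Bad p S n} {bm : Bad p S m} →
                          encodeBad n<p² bn ≡ encodeBad m<p² bm → n ≡ m
    encodeBad-injective {n<p² = n<p²} {m<p²} {inj₁ p²∣n} {inj₁ p²∣m} _ =
      trans (∣∧<⇒≡0 p²∣n n<p²) (sym (∣∧<⇒≡0 p²∣m m<p²))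
    encodeBad-injective {bn = inj₁ _} {inj₂ _} ()
    encodeBad-injective {bn = inj₂ _} {inj₁ _} ()
    encodeBad-injective {n} {m} {n<p²} {m<p²}
                        {inj₂ (d , _ , divides q eq)} {inj₂ (d′ , _ , divides q′ eq′)} code≡ =
      *-cancelˡ-≡ n m 10 (+-cancelʳ-≡ (toℕ d) (10 * n) (10 * m) (begin
        10 * n + toℕ d   ≡⟨ eq ⟩
        q * (p * p)      ≡⟨ cong (_* (p * p)) (fromℕ<-injective q q′ q<10 q′<10 (proj₂ same-code)) ⟩
        q′ * (p * p)     ≡⟨ eq′ ⟨
        10 * m + toℕ d′  ≡⟨ cong (λ e → 10 * m + toℕ e) (proj₁ same-code) ⟨
        10 * m + toℕ d   ∎))
      where
        open ≡-Reasoning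
        q<10 = quotient<10 {p * p} {n} {q} d n<p² eq
        q′<10 = quotient<10 {p * p} {m} {q′} d′ m<p² eq′
        same-code = combine-injective d (fromℕ< q<10) d′ (fromℕ< q′<10) (suc-injective code≡)

  ν≤101 : ∀ p S → ν p S ≤ 101
  ν≤101 p S = length-filter≤-encoding (bad? p S) (upTo⁺ (p * p))
    (λ n∈ → encodeBad p S (∈-upTo⁻ n∈)) (encodeBad-injective p S)

  ν≤p² : ∀ p S → ν p S ≤ p * p
  ν≤p² p S = ≤-trans (length-filter (bad? p S) (upTo (p * p))) (≤-reflexive (length-upTo (p * p)))

open BadResidues using (ν≤101; ν≤p²)

open import Data.Integer as ℤ using (+_)
import Data.Integer.Properties as ℤ
import Data.Nat.Tactic.RingSolver as ℕ-Solver
open import Data.Nat.Primality using (prime?)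
import Data.Nat.Properties as ℕₚ
open import Data.Rational using (ℚ; _+_; _*_; _-_; -_; _/_; ∣_∣; _≤_; 0ℚ; 1ℚ; toℚᵘ; nonNegative)
open import Data.Rational.Properties
  using (≤-refl; ≤-trans; ≤-reflexive; +-monoʳ-≤; +-monoˡ-≤; *-monoʳ-≤-nonNeg; neg-antimono-≤;
         +-assoc; +-identityʳ; +-identityˡ; *-identityˡ; nonNeg*nonNeg⇒nonNeg; +-inverseʳ; ∣-p∣≡∣p∣; 0≤p⇒∣p∣≡p;
         _≟_; +-*-commutativeRing; toℚᵘ-fromℚᵘ; toℚᵘ-homo-+; toℚᵘ-homo-*; toℚᵘ-cancel-≤; normalize-nonNeg; nonNegative⁻¹;
         module ≤-Reasoning)
open import Data.Rational.Unnormalised using (mkℚᵘ; *≤*) renaming (_≃_ to _≃ᵘ_)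
import Data.Rational.Unnormalised.Properties as ℚᵘ
open import Function using (_∘_)
open import Relation.Nullary using (yes; no)
open import Relation.Nullary.Decidable using (dec⇒maybe)
open import Tactic.RingSolver using (solve-∀)
open import Tactic.RingSolver.Core.AlmostCommutativeRing using (AlmostCommutativeRing; fromCommutativeRing)

-- Without the zero test the solver could not cancel terms such as p + - p.
ℚ-ring : AlmostCommutativeRing 0ℓ 0ℓ
ℚ-ring = fromCommutativeRing +-*-commutativeRing (λ p → dec⇒maybe (0ℚ ≟ p))

p≤p+q : ∀ {p q} → 0ℚ ≤ q → p ≤ p + q
p≤p+q {p} 0≤q = ≤-trans (≤-reflexive (sym (+-identityʳ p))) (+-monoʳ-≤ p 0≤q)

p-q≤p : ∀ {p q} → 0ℚ ≤ q → p - q ≤ p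
p-q≤p {p} 0≤q = ≤-trans (+-monoʳ-≤ p (neg-antimono-≤ 0≤q)) (≤-reflexive (+-identityʳ p))

0≤p*q : ∀ {p q} → 0ℚ ≤ p → 0ℚ ≤ q → 0ℚ ≤ p * q
0≤p*q {p} {q} 0≤p 0≤q = nonNegative⁻¹ (p * q)
  {{nonNeg*nonNeg⇒nonNeg p {{nonNegative 0≤p}} q {{nonNegative 0≤q}}}}

p≤q⇒0≤q-p : ∀ {p q} → p ≤ q → 0ℚ ≤ q - p
p≤q⇒0≤q-p {p} p≤q = ≤-trans (≤-reflexive (sym (+-inverseʳ p))) (+-monoˡ-≤ (- p) p≤q)

p≤q⇒∣p-q∣≡q-p : ∀ {p q} → p ≤ q → ∣ p - q ∣ ≡ q - p
p≤q⇒∣p-q∣≡q-p {p} {q} p≤q = begin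
  ∣ p - q ∣      ≡⟨ ∣-p∣≡∣p∣ (p - q) ⟨
  ∣ - (p - q) ∣  ≡⟨ cong ∣_∣ (neg-sub p q) ⟩
  ∣ q - p ∣      ≡⟨ 0≤p⇒∣p∣≡p (p≤q⇒0≤q-p p≤q) ⟩
  q - p          ∎
  where
    open ≡-Reasoning
    neg-sub : ∀ p q → - (p - q) ≡ q - p
    neg-sub = solve-∀ ℚ-ring

antitone-by-step : (f : ℕ → ℚ) → (∀ k → f (suc k) ≤ f k) → ∀ {m n} → m ℕ.≤ n → f n ≤ f m
antitone-by-step f step m≤n = go (ℕₚ.≤⇒≤′ m≤n)
  where
    go : ∀ {m n} → m ℕ.≤′ n → f n ≤ f m
    go ≤′-refl = ≤-refl
    go (≤′-step m≤′n) = ≤-trans (step _) (go m≤′n)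

0≤a/b : ∀ a k → 0ℚ ≤ (+ a) / suc k
0≤a/b a k = nonNegative⁻¹ _ {{normalize-nonNeg a (suc k)}}

toℚᵘ-/ : ∀ a k → toℚᵘ ((+ a) / suc k) ≃ᵘ mkℚᵘ (+ a) k
toℚᵘ-/ a k = toℚᵘ-fromℚᵘ (mkℚᵘ (+ a) k)

toℚᵘ-/+/ : ∀ a k b l → toℚᵘ ((+ a) / suc k + (+ b) / suc l) ≃ᵘ mkℚᵘ (+ (a ℕ.* suc l ℕ.+ b ℕ.* suc k)) (l ℕ.+ k ℕ.* suc l)
toℚᵘ-/+/ a k b l = ℚᵘ.≃-trans (toℚᵘ-homo-+ ((+ a) / suc k) ((+ b) / suc l))
  (ℚᵘ.≃-trans (ℚᵘ.+-cong (toℚᵘ-/ a k) (toℚᵘ-/ b l))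
    (ℚᵘ.≃-reflexive (cong (λ n → mkℚᵘ n (l ℕ.+ k ℕ.* suc l)) (sym
      (trans (ℤ.pos-+ (a ℕ.* suc l) (b ℕ.* suc k)) (cong₂ ℤ._+_ (ℤ.pos-* a (suc l)) (ℤ.pos-* b (suc k))))))))

toℚᵘ-/*/ : ∀ a k b l → toℚᵘ ((+ a) / suc k * ((+ b) / suc l)) ≃ᵘ mkℚᵘ (+ (a ℕ.* b)) (l ℕ.+ k ℕ.* suc l)
toℚᵘ-/*/ a k b l = ℚᵘ.≃-trans (toℚᵘ-homo-* ((+ a) / suc k) ((+ b) / suc l))
  (ℚᵘ.≃-trans (ℚᵘ.*-cong (toℚᵘ-/ a k) (toℚᵘ-/ b l))
    (ℚᵘ.≃-reflexive (cong (λ n → mkℚᵘ n (l ℕ.+ k ℕ.* suc l)) (sym (ℤ.pos-* a b)))))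

≤-by-cross-multiplication : ∀ {p q a k b l} → toℚᵘ p ≃ᵘ mkℚᵘ (+ a) k → toℚᵘ q ≃ᵘ mkℚᵘ (+ b) l →
                            a ℕ.* suc l ℕ.≤ b ℕ.* suc k → p ≤ q
≤-by-cross-multiplication {a = a} {k} {b} {l} p≃ q≃ ineq =
  toℚᵘ-cancel-≤ (ℚᵘ.≤-respˡ-≃ (ℚᵘ.≃-sym p≃) (ℚᵘ.≤-respʳ-≃ (ℚᵘ.≃-sym q≃)
    (*≤* (subst₂ ℤ._≤_ (ℤ.pos-* a (suc l)) (ℤ.pos-* b (suc k)) (ℤ.+≤+ ineq)))))

/-monoˡ-≤ : ∀ {a b} k → a ℕ.≤ b → (+ a) / suc k ≤ (+ b) / suc k
/-monoˡ-≤ {a} {b} k a≤b = ≤-by-cross-multiplication (toℚᵘ-/ a k) (toℚᵘ-/ b k) (ℕₚ.*-monoˡ-≤ (suc k) a≤b)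

a/b≤1 : ∀ {a} k → a ℕ.≤ suc k → (+ a) / suc k ≤ 1ℚ
a/b≤1 {a} k a≤1+k = ≤-by-cross-multiplication (toℚᵘ-/ a k) ℚᵘ.≃-refl
  (subst₂ ℕ._≤_ (sym (ℕₚ.*-identityʳ a)) (sym (ℕₚ.*-identityˡ (suc k))) a≤1+k)

a/b≤a/1*1/b : ∀ a k → (+ a) / suc k ≤ (+ a) / 1 * ((+ 1) / suc k)
a/b≤a/1*1/b a k = ≤-by-cross-multiplication (toℚᵘ-/ a k) (toℚᵘ-/*/ a 0 1 k) (ℕₚ.≤-reflexive (cleared a k))
  where
    cleared : ∀ a k → a ℕ.* suc (k ℕ.+ 0 ℕ.* suc k) ≡ a ℕ.* 1 ℕ.* suc k
    cleared = ℕ-Solver.solve-∀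

-- Cleared of denominators, the right side exceeds the left by B n (n+1).
tail-step : ∀ B n → (+ B) / (suc n ℕ.* suc n) + (+ (2 ℕ.* B)) / suc (suc n) ≤ (+ (2 ℕ.* B)) / suc n
tail-step B n = ≤-by-cross-multiplication (toℚᵘ-/+/ B (n ℕ.+ n ℕ.* suc n) (2 ℕ.* B) (suc n)) (toℚᵘ-/ (2 ℕ.* B) n)
  (subst (cleared ℕ.≤_) (slack B n) (ℕₚ.m≤m+n cleared (B ℕ.* suc n ℕ.* n)))
  where
    cleared = (B ℕ.* suc (suc n) ℕ.+ 2 ℕ.* B ℕ.* (suc n ℕ.* suc n)) ℕ.* suc n
    slack : ∀ B n → (B ℕ.* suc (suc n) ℕ.+ 2 ℕ.* B ℕ.* (suc n ℕ.* suc n)) ℕ.* suc n ℕ.+ B ℕ.* suc n ℕ.* n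
                    ≡ 2 ℕ.* B ℕ.* (suc n ℕ.* suc n ℕ.* suc (suc n))
    slack = ℕ-Solver.solve-∀

module _ (B : ℕ) (f : ℕ → ℚ) (step : ∀ k → f (suc k) ≤ f k + (+ B) / (suc k ℕ.* suc k)) where

  private
    potential : ℕ → ℚ
    potential k = f k + (+ (2 ℕ.* B)) / suc k

    potential-step : ∀ k → potential (suc k) ≤ potential k
    potential-step k = begin
      f (suc k) + (+ (2 ℕ.* B)) / suc (suc k)                              ≤⟨ +-monoˡ-≤ _ (step k) ⟩
      f k + (+ B) / (suc k ℕ.* suc k) + (+ (2 ℕ.* B)) / suc (suc k)        ≡⟨ +-assoc (f k) _ _ ⟩
      f k + ((+ B) / (suc k ℕ.* suc k) + (+ (2 ℕ.* B)) / suc (suc k))      ≤⟨ +-monoʳ-≤ (f k) (tail-step B k) ⟩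
      f k + (+ (2 ℕ.* B)) / suc k                                          ∎
      where open ≤-Reasoning

  inverse-square-increments : ∀ {m n} → m ℕ.≤ n → f n ≤ f m + (+ (2 ℕ.* B)) / suc m
  inverse-square-increments {n = n} m≤n =
    ≤-trans (p≤p+q (0≤a/b (2 ℕ.* B) n)) (antitone-by-step potential potential-step m≤n)

-- The denominator suc k * suc k is definitionally suc (k + k * suc k).
term-nonneg : ∀ S m → 0ℚ ≤ term S m
term-nonneg S zero = ≤-refl
term-nonneg S (suc k) with prime? (suc k)
... | yes _ = 0≤a/b (ν (suc k) S) (k ℕ.+ k ℕ.* suc k)
... | no _ = ≤-refl

term≤1 : ∀ S m → term S m ≤ 1ℚ
term≤1 S zero = 0≤a/b 1 0
term≤1 S (suc k) with prime? (suc k)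
... | yes _ = a/b≤1 (k ℕ.+ k ℕ.* suc k) (ν≤p² (suc k) S)
... | no _ = 0≤a/b 1 0

term≤101/m² : ∀ S k → term S (suc k) ≤ (+ 101) / (suc k ℕ.* suc k)
term≤101/m² S k with prime? (suc k)
... | yes _ = /-monoˡ-≤ (k ℕ.+ k ℕ.* suc k) (ν≤101 (suc k) S)
... | no _ = 0≤a/b 101 (k ℕ.+ k ℕ.* suc k)

factor≡1-term : ∀ S m → factor S m ≡ 1ℚ - term S m
factor≡1-term S zero = refl
factor≡1-term S (suc k) with prime? (suc k)
... | yes _ = refl
... | no _ = refl

Cz-suc : ∀ S z → Cz S (suc z) ≡ Cz S z - Cz S z * term S (suc z)
Cz-suc S z = trans (cong (Cz S z *_) (factor≡1-term S (suc z))) (expand (Cz S z) (term S (suc z)))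
  where
    expand : ∀ c t → c * (1ℚ - t) ≡ c - c * t
    expand = solve-∀ ℚ-ring

factor-nonneg : ∀ S m → 0ℚ ≤ factor S m
factor-nonneg S m = subst (0ℚ ≤_) (sym (factor≡1-term S m)) (p≤q⇒0≤q-p (term≤1 S m))

Cz-nonneg : ∀ S z → 0ℚ ≤ Cz S z
Cz-nonneg S zero = factor-nonneg S zero
Cz-nonneg S (suc z) = 0≤p*q (Cz-nonneg S z) (factor-nonneg S (suc z))

Cz-antitone : ∀ S {z z′} → z ℕ.≤ z′ → Cz S z′ ≤ Cz S z
Cz-antitone S = antitone-by-step (Cz S) λ z →
  subst (_≤ Cz S z) (sym (Cz-suc S z)) (p-q≤p (0≤p*q (Cz-nonneg S z) (term-nonneg S (suc z))))

Cz≤1 : ∀ S z → Cz S z ≤ 1ℚ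
Cz≤1 S z = Cz-antitone S {0} {z} ℕ.z≤n

Σterm≤202 : ∀ S z → Σterm S z ≤ (+ 202) / 1
Σterm≤202 S z = ≤-trans
  (inverse-square-increments 101 (Σterm S) (λ k → +-monoʳ-≤ (Σterm S k) (term≤101/m² S k)) {0} {z} ℕ.z≤n)
  (≤-reflexive (+-identityˡ _))

neg-Cz-suc≤ : ∀ S k → - Cz S (suc k) ≤ - Cz S k + (+ 101) / (suc k ℕ.* suc k)
neg-Cz-suc≤ S k = begin
  - Cz S (suc k)          ≡⟨ cong -_ (Cz-suc S k) ⟩
  - (c - c * t)           ≡⟨ neg-sub c (c * t) ⟩
  - c + c * t             ≤⟨ +-monoʳ-≤ (- c) (*-monoʳ-≤-nonNeg t {{nonNegative (term-nonneg S (suc k))}} (Cz≤1 S k)) ⟩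
  - c + 1ℚ * t            ≡⟨ cong (_+_ (- c)) (*-identityˡ t) ⟩
  - c + t                 ≤⟨ +-monoʳ-≤ (- c) (term≤101/m² S k) ⟩
  - c + (+ 101) / (suc k ℕ.* suc k) ∎
  where
    open ≤-Reasoning
    c = Cz S k
    t = term S (suc k)
    neg-sub : ∀ p q → - (p - q) ≡ - p + q
    neg-sub = solve-∀ ℚ-ring

Cz-Cauchy : ∀ S {z z′} → z ℕ.≤ z′ → ∣ Cz S z′ - Cz S z ∣ ≤ (+ 202) / suc z
Cz-Cauchy S {z} {z′} z≤z′ = begin
  ∣ Cz S z′ - Cz S z ∣         ≡⟨ p≤q⇒∣p-q∣≡q-p (Cz-antitone S z≤z′) ⟩
  Cz S z - Cz S z′             ≤⟨ +-monoʳ-≤ (Cz S z) (inverse-square-increments 101 (-_ ∘ Cz S) (neg-Cz-suc≤ S) z≤z′) ⟩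
  Cz S z + (- Cz S z + ε)      ≡⟨ cancel (Cz S z) ε ⟩
  ε                            ∎
  where
    open ≤-Reasoning
    ε = (+ 202) / suc z
    cancel : ∀ p q → p + (- p + q) ≡ q
    cancel = solve-∀ ℚ-ring

mainTheorem6 : (∀ (S : Digits) → ∃ λ (M : ℚ) → ∀ (z : ℕ) → Σterm S z ≤ M)
    × (∃ λ (K : ℚ) → ∀ (S : Digits) (z z′ : ℕ) → 7 ℕ.≤ z → z ℕ.≤ z′
    → ∣ Cz S z′ - Cz S z ∣ ≤ K * ((+ 1) / suc z))
mainTheorem6 =
  (λ S → (+ 202) / 1 , Σterm≤202 S) ,
  ((+ 202) / 1 , λ S z z′ _ z≤z′ → ≤-trans (Cz-Cauchy S z≤z′) (a/b≤a/1*1/b 202 z))
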